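{- Let $k\ge 2$ and let $R\subset\{0,1\}^k$ with $|R|=2^k-1$ (a $k$-clause). Then $R$ is not preserved by the $k$-universal operation $u_k$.
   Context: $u_k$: the Boolean partial operation of arity $2^k-1$ with arguments indexed by $v\in\{0,1\}^k\setminus\{0^k\}$; for $j\in[k]$ let $s_j[v]=v[j]$; its domain is the two constant tuples (mapped to the constant), the $s_j$ (mapped to $0$) and their complements (mapped to $1$). It is applied to tuples coordinatewise (defined iff defined in every coordinate); $R$ is preserved by $u_k$ if every defined application of $u_k$ to tuples of $R$ lies in $R$. -}

module Defs where

open import Data.Bool using (Bool; true; false; not)
open import Data.Nat using (ℕ)
open import Data.Fin using (Fin)
open import Data.Vec using (Vec; lookup)
open import Data.Vec.Relation.Unary.Any using (Any)
open import Data.Product using (Σ; proj₁)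
open import Data.List using (List)
open import Data.List.Membership.Propositional using (_∈_)
open import Relation.Binary.PropositionalEquality using (_≡_)

-- Boolean k-tuples (elements of {0,1}^k), false = 0, true = 1.
Tuple : ℕ → Set
Tuple k = Vec Bool k

-- Index set of the arguments of u_k: the nonzero vectors v ∈ {0,1}^k.
Idx : ℕ → Set
Idx k = Σ (Tuple k) (λ v → Any (_≡ true) v)

-- Graph of the partial operation u_k : Bool^(Idx k) ⇀ Bool.
-- UkGraph k a b  means  u_k(a) is defined and equals b.
data UkGraph (k : ℕ) (a : Idx k → Bool) : Bool → Set where
  const : (c : Bool) → (∀ i → a i ≡ c) → UkGraph k a c
  proj  : (j : Fin k) → (∀ i → a i ≡ lookup (proj₁ i) j) → UkGraph k a false
  coproj : (j : Fin k) → (∀ i → a i ≡ not (lookup (proj₁ i) j)) → UkGraph k a true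

UkApp : (k : ℕ) → (Idx k → Tuple k) → Tuple k → Set
UkApp k t r = ∀ (m : Fin k) → UkGraph k (λ i → lookup (t i) m) (lookup r m)

PreservedByUk : (k : ℕ) → List (Tuple k) → Set
PreservedByUk k R = ∀ (t : Idx k → Tuple k) (r : Tuple k) →
  (∀ i → t i ∈ R) → UkApp k t r → r ∈ R

-- A k-clause R misses exactly one tuple x. Every translate x ⊕ v by a nonzero v lies in R,
-- and feeding these translates to u_k (argument v gets x ⊕ v) computes x coordinatewise:
-- in coordinate m the argument family is s_m if x[m] = 0 and its complement if x[m] = 1.
-- So u_k maps tuples of R to x ∉ R.
module Submission where

open import Defs
open import Data.Nat using (ℕ; _≤_; _^_; _∸_)
open import Data.List using (List; length)
open import Data.List.Relation.Unary.Unique.Propositional using (Unique)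
open import Relation.Binary.PropositionalEquality using (_≡_)
open import Relation.Nullary using (¬_)

open import Data.Bool using (Bool; true; false; _xor_)
import Data.Bool as Bool
open import Data.Empty using (⊥; ⊥-elim)
open import Data.Fin using (Fin)
open import Data.List using ([]; _∷_; [_]; map; _++_)
open import Data.List.Membership.Propositional using (_∈_; _∉_)
open import Data.List.Membership.Propositional.Properties using (∈-map⁺; ∈-map⁻; ∈-++⁺ˡ; ∈-++⁺ʳ)
open import Data.List.Properties using (length-++; length-map; length-removeAt′)
open import Data.List.Relation.Binary.Subset.Propositional using (_⊆_)
open import Data.List.Relation.Unary.All using (all?)
import Data.List.Relation.Unary.All as All
open import Data.List.Relation.Unary.All.Properties using (¬All⇒Any¬; ¬Any⇒All¬)
open import Data.List.Relation.Unary.AllPairs using ([]; _∷_)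
open import Data.List.Relation.Unary.Any using (here; there; index; satisfied; _─_)
import Data.List.Relation.Unary.Unique.Propositional.Properties as Unique
open import Data.Nat using (zero; suc; _+_; z≤n; s≤s)
open import Data.Nat.Properties using (+-identityʳ; n≮n; suc-pred; m^n≢0)
open import Data.Product using (∃; _,_; _×_; proj₁; proj₂)
open import Data.Vec using ([]; _∷_; lookup; zipWith)
open import Data.Vec.Properties using (≡-dec; ∷-injectiveʳ; lookup-zipWith)
import Data.Vec.Relation.Unary.Any as Vec
open import Relation.Binary.Definitions using (DecidableEquality)
open import Relation.Binary.PropositionalEquality using (_≢_; refl; sym; trans; cong; cong₂; subst)
open import Relation.Nullary using (yes; no)
open import Relation.Nullary.Decidable using (decidable-stable)

module _ {A : Set} where

  ∈-─⁺ : ∀ {x z} {ys : List A} (x∈ys : x ∈ ys) → z ≢ x → z ∈ ys → z ∈ (ys ─ x∈ys)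
  ∈-─⁺ (here refl) z≢x (here refl) = ⊥-elim (z≢x refl)
  ∈-─⁺ (here _)    _   (there z∈ys) = z∈ys
  ∈-─⁺ (there _)   _   (here z≡y) = here z≡y
  ∈-─⁺ (there x∈ys) z≢x (there z∈ys) = there (∈-─⁺ x∈ys z≢x z∈ys)

  Unique-⊆⇒length-≤ : ∀ {xs ys : List A} → Unique xs → xs ⊆ ys → length xs ≤ length ys
  Unique-⊆⇒length-≤ [] _ = z≤n
  Unique-⊆⇒length-≤ {x ∷ xs} {ys} (x∉xs ∷ xs!) xs⊆ys =
    subst (suc (length xs) ≤_) (sym (length-removeAt′ ys (index x∈ys)))
      (s≤s (Unique-⊆⇒length-≤ xs! xs⊆ys─x))
    where
    x∈ys : x ∈ ys
    x∈ys = xs⊆ys (here refl)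
    xs⊆ys─x : xs ⊆ (ys ─ x∈ys)
    xs⊆ys─x z∈xs = ∈-─⁺ x∈ys (λ z≡x → All.lookup x∉xs z∈xs (sym z≡x)) (xs⊆ys (there z∈xs))

module _ {A : Set} (_≟_ : DecidableEquality A) where

  open import Data.List.Membership.DecPropositional _≟_ using (_∈?_)

  ∃-sole-nonmember : ∀ {all R : List A} → Unique all → (∀ x → x ∈ all) →
                     Unique R → suc (length R) ≡ length all →
                     ∃ λ x → x ∉ R × (∀ y → y ≢ x → y ∈ R)
  ∃-sole-nonmember {all} {R} all! complete R! len = x , x∉R , others
    where
    ¬all⊆R : ¬ all ⊆ R
    ¬all⊆R all⊆R = n≮n _ (subst (_≤ length R) (sym len) (Unique-⊆⇒length-≤ all! all⊆R))

    missing : ∃ λ x → x ∉ R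
    missing with all? (_∈? R) all
    ... | yes all∈R = ⊥-elim (¬all⊆R (All.lookup all∈R))
    ... | no ¬all∈R = satisfied (¬All⇒Any¬ (_∈? R) all ¬all∈R)

    x : A
    x = proj₁ missing
    x∉R : x ∉ R
    x∉R = proj₂ missing

    others : ∀ y → y ≢ x → y ∈ R
    others y y≢x = decidable-stable (y ∈? R) two-missing
      where
      two-missing : y ∉ R → ⊥
      two-missing y∉R = n≮n _ (subst (suc (suc (length R)) ≤_) (sym len)
        (Unique-⊆⇒length-≤ x∷y∷R! (λ {z} _ → complete z)))
        where
        x∷y∷R! : Unique (x ∷ y ∷ R)
        x∷y∷R! = ((λ x≡y → y≢x (sym x≡y)) All.∷ ¬Any⇒All¬ R x∉R) ∷ ¬Any⇒All¬ R y∉R ∷ R!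

allTuples : (k : ℕ) → List (Tuple k)
allTuples zero = [ [] ]
allTuples (suc k) = map (false ∷_) (allTuples k) ++ map (true ∷_) (allTuples k)

length-allTuples : ∀ k → length (allTuples k) ≡ 2 ^ k
length-allTuples zero = refl
length-allTuples (suc k) = trans (length-++ (map (false ∷_) (allTuples k)))
  (cong₂ _+_ (trans (length-map (false ∷_) (allTuples k)) (length-allTuples k))
             (trans (trans (length-map (true ∷_) (allTuples k)) (length-allTuples k))
                    (sym (+-identityʳ (2 ^ k)))))

∈-allTuples : ∀ {k} (t : Tuple k) → t ∈ allTuples k
∈-allTuples [] = here refl
∈-allTuples {suc k} (false ∷ t) = ∈-++⁺ˡ (∈-map⁺ (false ∷_) (∈-allTuples t))
∈-allTuples {suc k} (true ∷ t) =
  ∈-++⁺ʳ (map (false ∷_) (allTuples k)) (∈-map⁺ (true ∷_) (∈-allTuples t))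

allTuples-Unique : ∀ k → Unique (allTuples k)
allTuples-Unique zero = All.[] ∷ []
allTuples-Unique (suc k) =
  Unique.++⁺ (Unique.map⁺ ∷-injectiveʳ (allTuples-Unique k))
             (Unique.map⁺ ∷-injectiveʳ (allTuples-Unique k)) disjoint
  where
  disjoint : ∀ {t} → ¬ (t ∈ map (false ∷_) (allTuples k) × t ∈ map (true ∷_) (allTuples k))
  disjoint (t∈₀ , t∈₁) with ∈-map⁻ (false ∷_) t∈₀ | ∈-map⁻ (true ∷_) t∈₁
  ... | _ , _ , refl | _ , _ , ()

_⊕_ : ∀ {k} → Tuple k → Tuple k → Tuple k
_⊕_ = zipWith _xor_

⊕-nonzero-≢ : ∀ {k} (x v : Tuple k) → Vec.Any (_≡ true) v → x ⊕ v ≢ x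
⊕-nonzero-≢ (false ∷ _) (_ ∷ _) (Vec.here refl) ()
⊕-nonzero-≢ (true ∷ _) (_ ∷ _) (Vec.here refl) ()
⊕-nonzero-≢ (_ ∷ x) (_ ∷ v) (Vec.there v≢0) eq = ⊕-nonzero-≢ x v v≢0 (∷-injectiveʳ eq)

UkGraph-resp : ∀ {k} {a a′ : Idx k → Bool} {b} → (∀ i → a i ≡ a′ i) → UkGraph k a b → UkGraph k a′ b
UkGraph-resp a≗a′ (const c a≡c) = const c (λ i → trans (sym (a≗a′ i)) (a≡c i))
UkGraph-resp a≗a′ (proj j a≡s) = proj j (λ i → trans (sym (a≗a′ i)) (a≡s i))
UkGraph-resp a≗a′ (coproj j a≡¬s) = coproj j (λ i → trans (sym (a≗a′ i)) (a≡¬s i))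

UkGraph-xor-proj : ∀ {k} (b : Bool) (j : Fin k) → UkGraph k (λ i → b xor lookup (proj₁ i) j) b
UkGraph-xor-proj false j = proj j (λ _ → refl)
UkGraph-xor-proj true j = coproj j (λ _ → refl)

UkApp-translates : ∀ {k} (x : Tuple k) → UkApp k (λ i → x ⊕ proj₁ i) x
UkApp-translates x m =
  UkGraph-resp (λ i → sym (lookup-zipWith _xor_ m x (proj₁ i))) (UkGraph-xor-proj (lookup x m) m)

¬PreservedByUk-co-singleton : ∀ {k} (R : List (Tuple k)) (x : Tuple k) →
                              x ∉ R → (∀ y → y ≢ x → y ∈ R) → ¬ PreservedByUk k R
¬PreservedByUk-co-singleton R x x∉R others preserved =
  x∉R (preserved (λ i → x ⊕ proj₁ i) x
                 (λ i → others (x ⊕ proj₁ i) (⊕-nonzero-≢ x (proj₁ i) (proj₂ i)))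
                 (UkApp-translates x))

lemma2 : (k : ℕ) → 2 ≤ k → (R : List (Tuple k)) → Unique R →
           length R ≡ 2 ^ k ∸ 1 → ¬ PreservedByUk k R
lemma2 k _ R R! len =
  let x , x∉R , others = ∃-sole-nonmember (≡-dec Bool._≟_) (allTuples-Unique k) ∈-allTuples R! len′
  in ¬PreservedByUk-co-singleton R x x∉R others
  where
  len′ : suc (length R) ≡ length (allTuples k)
  len′ = trans (cong suc len)
               (trans (suc-pred (2 ^ k) {{m^n≢0 2 k}}) (sym (length-allTuples k)))
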